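{- Let $\pi\in\mathcal D(n)$ have bounce points $b_0,\dots,b_m$ and let $1\le i\le m$. If $\pi\cdot U_i\neq\bot$, then $\mathbf a(\pi\cdot U_i)=\mathbf a(\pi)-1$ and $\mathbf b(\pi\cdot U_i)=\mathbf b(\pi)+1$.
   Context: A Dyck path of semilength $n$ is a lattice path from $(0,0)$ to $(n,n)$ with unit north and east steps never going below $y=x$; $\mathcal D(n)$ is their set. Row $j$ is the strip $j-1\le y\le j$, column $i$ the strip $i-1\le x\le i$. For a path let $x_j$ be the $x$-coordinate of its north step in row $j$ and $h_i$ the $y$-coordinate of its east step in column $i$; set $h_0=0$. Area $\mathbf a(\pi)=\sum_j((j-1)-x_j)$. Bounce points: $b_0=0$, $b_k=h_{b_{k-1}+1}$ until $b_m=n$; bounce $\mathbf b(\pi)=\sum_{k=1}^m(n-b_k)$. Operators act on the right on $\mathcal D(n)\cup\{\bot\}$, composed left to right, fixing $\bot$; $X^{ -k}=(X^{ -1})^k$, $X^0=\mathrm{id}$. $A_i$ / $A_i^{ -1}$ replace $x_i$ by $x_i\mp1$; $C_i$ / $C_i^{ -1}$ replace $h_i$ by $h_i\pm1$; result $\bot$ if not a Dyck path. Operator $U_i$ ($1\le i\le m$): let $u=0$ if $i=m$ and $u=b_{i+1}-h_{b_i}$ otherwise, and $\beta_j=h_{b_{i-1}+u+2-j}-b_i+1$ for $1\le j\le u$. If $h_{b_{i-1}}=b_i$ then $\pi\cdot U_i=\bot$; otherwise $\pi\cdot U_i=\pi\cdot C_{b_{i-1}+1}^{ -1}\,C_{b_{i-1}+2}^{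 -\beta_u}C_{b_{i-1}+3}^{ -\beta_{u-1}}\cdots C_{b_{i-1}+1+u}^{ -\beta_1}\,A_{b_{i+1}-u+1}^{\beta_1}A_{b_{i+1}-u+2}^{\beta_2}\cdots A_{b_{i+1}}^{\beta_u}$ (which may be $\bot$). -}

module Defs where

open import Data.Nat using (ℕ; zero; suc; _+_; _∸_; _<ᵇ_; _≤ᵇ_; _≡ᵇ_)
open import Data.Bool using (Bool; true; false; _∧_; if_then_else_; T)
open import Data.List using (List; []; _∷_; length; map; upTo; filterᵇ)
open import Data.Nat.ListAction using (sum)
open import Data.Bool.ListAction using (and)
open import Data.Maybe using (Maybe; just; nothing; _>>=_)

-- A Dyck path π ∈ 𝒟(n) is represented by the list [x_1, …, x_n] of the
-- x-coordinates of its north steps (row j = strip j-1 ≤ y ≤ j).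
-- A lattice path with N/E steps from (0,0) to (n,n) is determined by this
-- list; it stays weakly above y = x iff the list is weakly increasing and
-- x_j ≤ j - 1 for every j.  (x_j ≥ 0 is automatic in ℕ.)
-- "⊥" is represented by 'nothing'.

nth : List ℕ → ℕ → ℕ
nth []       _       = 0
nth (x ∷ xs) zero    = x
nth (x ∷ xs) (suc k) = nth xs k

-- 1-indexed lookup; index 0 gives 0 (used for h_0 = 0 and b_0 = 0)
at : List ℕ → ℕ → ℕ
at xs zero    = 0
at xs (suc k) = nth xs k

setNth : List ℕ → ℕ → ℕ → List ℕ
setNth []       _       v = []
setNth (x ∷ xs) zero    v = v ∷ xs
setNth (x ∷ xs) (suc k) v = x ∷ setNth xs k v

setAt : List ℕ → ℕ → ℕ → List ℕ
setAt xs zero    v = xs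
setAt xs (suc k) v = setNth xs k v

range : ℕ → List ℕ
range n = map suc (upTo n)

count : (ℕ → Bool) → List ℕ → ℕ
count p xs = length (filterᵇ p xs)

nondecᵇ : List ℕ → Bool
nondecᵇ []           = true
nondecᵇ (x ∷ [])     = true
nondecᵇ (x ∷ y ∷ r)  = (x ≤ᵇ y) ∧ nondecᵇ (y ∷ r)

eqListᵇ : List ℕ → List ℕ → Bool
eqListᵇ []       []       = true
eqListᵇ (x ∷ xs) (y ∷ ys) = (x ≡ᵇ y) ∧ eqListᵇ xs ys
eqListᵇ _        _        = false

isDyckᵇ : ℕ → List ℕ → Bool
isDyckᵇ n xs = (length xs ≡ᵇ n) ∧ nondecᵇ xs
               ∧ and (map (λ j → at xs j ≤ᵇ (j ∸ 1)) (range n))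

IsDyck : ℕ → List ℕ → Set
IsDyck n xs = T (isDyckᵇ n xs)

xc : List ℕ → ℕ → ℕ
xc xs j = at xs j

-- h_i = y-coordinate of the east step in column i
--     = number of north steps with x-coordinate < i.  (Gives h_0 = 0.)
hc : List ℕ → ℕ → ℕ
hc xs i = count (λ x → x <ᵇ i) xs

hseq : ℕ → List ℕ → List ℕ
hseq n xs = map (hc xs) (range n)

-- inverse: x_j = number of east steps with height < j
xFromH : ℕ → List ℕ → List ℕ
xFromH n hs = map (λ j → count (λ h → h <ᵇ j) hs) (range n)

Op : Set
Op = List ℕ → Maybe (List ℕ)

_·_ : Maybe (List ℕ) → Op → Maybe (List ℕ)
p · f = p >>= f

infixl 5 _·_

pow : Op → ℕ → Op
pow f zero    xs = just xs
pow f (suc k) xs = just xs · f · pow f k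

seqOps : List Op → Op
seqOps []       xs = just xs
seqOps (f ∷ fs) xs = just xs · f · seqOps fs

mkPath : ℕ → List ℕ → Maybe (List ℕ)
mkPath n xs = if isDyckᵇ n xs then just xs else nothing

pathFromH : ℕ → List ℕ → Maybe (List ℕ)
pathFromH n hs =
  let xs = xFromH n hs in
  if isDyckᵇ n xs ∧ eqListᵇ (hseq n xs) hs then just xs else nothing

inRange : ℕ → ℕ → Bool
inRange n i = (1 ≤ᵇ i) ∧ (i ≤ᵇ n)

A : ℕ → ℕ → Op
A n i xs = if inRange n i ∧ (1 ≤ᵇ xc xs i)
           then mkPath n (setAt xs i (xc xs i ∸ 1)) else nothing

Ainv : ℕ → ℕ → Op
Ainv n i xs = if inRange n i then mkPath n (setAt xs i (xc xs i + 1)) else nothing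

C : ℕ → ℕ → Op
C n i xs = if inRange n i
           then pathFromH n (setAt (hseq n xs) i (hc xs i + 1)) else nothing

Cinv : ℕ → ℕ → Op
Cinv n i xs = if inRange n i ∧ (1 ≤ᵇ hc xs i)
              then pathFromH n (setAt (hseq n xs) i (hc xs i ∸ 1)) else nothing

-- b_{k+1} = h_{b_k + 1}, until reaching n  (fuel n suffices since b strictly increases)
bounceFrom : ℕ → List ℕ → ℕ → ℕ → List ℕ
bounceFrom n xs zero       b = []
bounceFrom n xs (suc fuel) b =
  if b <ᵇ n then hc xs (b + 1) ∷ bounceFrom n xs fuel (hc xs (b + 1)) else []

bouncePts : ℕ → List ℕ → List ℕ
bouncePts n xs = bounceFrom n xs n 0

bp : ℕ → List ℕ → ℕ → ℕ
bp n xs k = at (bouncePts n xs) k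

nBounce : ℕ → List ℕ → ℕ
nBounce n xs = length (bouncePts n xs)

area : ℕ → List ℕ → ℕ
area n xs = sum (map (λ j → (j ∸ 1) ∸ xc xs j) (range n))

bounce : ℕ → List ℕ → ℕ
bounce n xs = sum (map (λ b → n ∸ b) (bouncePts n xs))

U : ℕ → ℕ → Op
U n i xs =
  let m  = nBounce n xs
      b  = bp n xs
      h  = hc xs
      u  = if i ≡ᵇ m then 0 else b (i + 1) ∸ h (b i)
      β  = λ j → (h (b (i ∸ 1) + u + 2 ∸ j) ∸ b i) + 1
      cs = map (λ k → pow (Cinv n (b (i ∸ 1) + 1 + k)) (β (u + 1 ∸ k))) (range u)
      as = map (λ k → pow (A n (b (i + 1) ∸ u + k)) (β k)) (range u)
  in if h (b (i ∸ 1)) ≡ᵇ b i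
     then nothing
     else seqOps (Cinv n (b (i ∸ 1) + 1) ∷ (cs Data.List.++ as)) xs

module Submission where

-- Write π as its row abscissae x_j and its column heights h_c = #{j | x_j < c}; for a Dyck
-- path these determine each other through the Galois connection r ≤ h_c ⇔ x_r < c.
--
-- Since Σ_c h_c + Σ_j x_j = n², every C⁻¹ step lowers one height and raises Σ x by one,
-- while every A step lowers Σ x by one. U_i performs 1 + Σ β_j steps C⁻¹ and Σ β_j steps A,
-- so Σ x grows by exactly one and the area drops by one.
--
-- Put p = b_{i-1}, b = b_i, b′ = b_{i+1}. The C⁻¹ steps level the columns p+1, …, p+1+u
-- to height b - 1, which on a Dyck path forces p+1+u < b. The rows h_b + 1, …, b′ are exactly
-- the rows at abscissa b, and the A steps move them to the left of b. Reading the heights of σ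
-- back through the Galois connection: they agree with those of π at columns ≤ p and > b, while
-- h_{p+1} = b - 1 and h_b = b′. So the bounce path of σ is that of π with b replaced by b - 1
-- (for i = m, with n - 1 inserted before n), and the bounce grows by one.

open import Algebra.Properties.CommutativeSemigroup using (interchange)
open import Data.Bool using (Bool; true; false; T; _∧_; if_then_else_)
open import Data.Bool.ListAction using (and)
open import Data.Bool.Properties using (T-∧)
open import Data.Empty using (⊥-elim)
open import Data.List using (List; []; _∷_; _++_; length; map; upTo; applyUpTo; applyDownFrom)
open import Data.List.Properties
  using (map-∘; map-upTo; map-++; length-++; length-applyUpTo; length-filter; reverse-applyDownFrom)
open import Data.List.Relation.Binary.Permutation.Propositional.Properties using (↭-reverse)
open import Data.Maybe using (Maybe; just; nothing; _>>=_)
open import Data.Nat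
  using (ℕ; zero; suc; _+_; _*_; _∸_; _≤_; _<_; z≤n; s≤s; s≤s⁻¹; _<ᵇ_; _≤ᵇ_; _≡ᵇ_; _<?_; _≤?_)
open import Data.Nat.ListAction using (sum)
open import Data.Nat.ListAction.Properties using (sum-++; sum-↭)
open import Data.Nat.Properties
open import Data.Nat.Tactic.RingSolver using (solve-∀)
open import Data.Product using (∃-syntax; _×_; _,_; proj₁; proj₂)
open import Data.Sum using (_⊎_; inj₁; inj₂)
open import Data.Unit using (tt)
open import Function using (_∘_; Equivalence)
open import Relation.Binary.PropositionalEquality
open import Relation.Nullary using (yes; no; contradiction)
open import Relation.Nullary.Decidable using (T?)

open import Defs

private
  variable
    a c d e i j k n r x y : ℕ
    xs ys zs ws vs pre rest π σ : List ℕ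
    h h′ : ℕ → ℕ

∧-split : ∀ {s t} → T (s ∧ t) → T s × T t
∧-split = Equivalence.to T-∧

nth-setNth-same : ∀ xs → j < length xs → nth (setNth xs j y) j ≡ y
nth-setNth-same {zero}  (x ∷ xs) _        = refl
nth-setNth-same {suc j} (x ∷ xs) (s≤s j<) = nth-setNth-same xs j<

nth-setNth-other : ∀ xs → k ≢ j → nth (setNth xs j y) k ≡ nth xs k
nth-setNth-other {k}     {j}     []       k≢j = refl
nth-setNth-other {zero}  {zero}  (x ∷ xs) k≢j = ⊥-elim (k≢j refl)
nth-setNth-other {zero}  {suc j} (x ∷ xs) k≢j = refl
nth-setNth-other {suc k} {zero}  (x ∷ xs) k≢j = refl
nth-setNth-other {suc k} {suc j} (x ∷ xs) k≢j = nth-setNth-other xs (k≢j ∘ cong suc)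

sum-setNth : ∀ xs → j < length xs → sum (setNth xs j y) + nth xs j ≡ sum xs + y
sum-setNth {zero}  {y} (x ∷ xs) _ = begin
  y + sum xs + x   ≡⟨ +-comm (y + sum xs) x ⟩
  x + (y + sum xs) ≡⟨ cong (x +_) (+-comm y (sum xs)) ⟩
  x + (sum xs + y) ≡⟨ +-assoc x (sum xs) y ⟨
  x + sum xs + y   ∎
  where open ≡-Reasoning
sum-setNth {suc j} {y} (x ∷ xs) (s≤s j<) = begin
  x + sum (setNth xs j y) + nth xs j   ≡⟨ +-assoc x _ _ ⟩
  x + (sum (setNth xs j y) + nth xs j) ≡⟨ cong (x +_) (sum-setNth xs j<) ⟩
  x + (sum xs + y)                     ≡⟨ +-assoc x _ _ ⟨
  x + sum xs + y                       ∎
  where open ≡-Reasoning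

sum-setNth-pred : ∀ xs → j < length xs → 1 ≤ nth xs j → sum (setNth xs j (nth xs j ∸ 1)) + 1 ≡ sum xs
sum-setNth-pred {j} xs j< 1≤x = +-cancelʳ-≡ (nth xs j ∸ 1) _ _ (begin
  s′ + 1 + (nth xs j ∸ 1)   ≡⟨ +-assoc s′ 1 _ ⟩
  s′ + (1 + (nth xs j ∸ 1)) ≡⟨ cong (s′ +_) (m+[n∸m]≡n 1≤x) ⟩
  s′ + nth xs j             ≡⟨ sum-setNth xs j< ⟩
  sum xs + (nth xs j ∸ 1)   ∎)
  where
  open ≡-Reasoning
  s′ = sum (setNth xs j (nth xs j ∸ 1))

nth-++ʳ : ∀ xs {ys} k → nth (xs ++ ys) (length xs + k) ≡ nth ys k
nth-++ʳ []       k = refl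
nth-++ʳ (x ∷ xs) k = nth-++ʳ xs k

at≡nth-0∷ : ∀ xs k → at xs k ≡ nth (0 ∷ xs) k
at≡nth-0∷ xs zero    = refl
at≡nth-0∷ xs (suc k) = refl

nth-applyUpTo : ∀ (f : ℕ → ℕ) M → k < M → nth (applyUpTo f M) k ≡ f k
nth-applyUpTo {zero}  f (suc M) _        = refl
nth-applyUpTo {suc k} f (suc M) (s≤s k<) = nth-applyUpTo (f ∘ suc) M k<

applyUpTo-nth : ∀ xs → applyUpTo (nth xs) (length xs) ≡ xs
applyUpTo-nth []       = refl
applyUpTo-nth (x ∷ xs) = cong (x ∷_) (applyUpTo-nth xs)

map-range : ∀ {B : Set} (f : ℕ → B) M → map f (range M) ≡ applyUpTo (f ∘ suc) M
map-range f M = trans (sym (map-∘ (upTo M))) (map-upTo (f ∘ suc) M)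

applyUpTo-cong : ∀ {B : Set} {f g : ℕ → B} M → (∀ k → k < M → f k ≡ g k) → applyUpTo f M ≡ applyUpTo g M
applyUpTo-cong zero    f≡g = refl
applyUpTo-cong (suc M) f≡g = cong₂ _∷_ (f≡g 0 (s≤s z≤n)) (applyUpTo-cong M (λ k k< → f≡g (suc k) (s≤s k<)))

and-applyUpTo : ∀ (P : ℕ → Bool) M → T (and (applyUpTo P M)) → k < M → T (P k)
and-applyUpTo {zero}  P (suc M) t _        = proj₁ (∧-split t)
and-applyUpTo {suc k} P (suc M) t (s≤s k<) = and-applyUpTo (P ∘ suc) M (proj₂ (∧-split t)) k<

sum-applyUpTo-+ : ∀ (f g : ℕ → ℕ) M →
                  sum (applyUpTo (λ k → f k + g k) M) ≡ sum (applyUpTo f M) + sum (applyUpTo g M)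
sum-applyUpTo-+ f g zero    = refl
sum-applyUpTo-+ f g (suc M) = begin
  f 0 + g 0 + sum (applyUpTo (λ k → f (suc k) + g (suc k)) M)
    ≡⟨ cong (f 0 + g 0 +_) (sum-applyUpTo-+ (f ∘ suc) (g ∘ suc) M) ⟩
  f 0 + g 0 + (sum (applyUpTo (f ∘ suc) M) + sum (applyUpTo (g ∘ suc) M))
    ≡⟨ interchange +-commutativeSemigroup (f 0) (g 0) _ _ ⟩
  f 0 + sum (applyUpTo (f ∘ suc) M) + (g 0 + sum (applyUpTo (g ∘ suc) M))
    ∎
  where open ≡-Reasoning

sum-applyUpTo-∸ : ∀ (f g : ℕ → ℕ) M → (∀ k → k < M → g k ≤ f k) →
                  sum (applyUpTo (λ k → f k ∸ g k) M) + sum (applyUpTo g M) ≡ sum (applyUpTo f M)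
sum-applyUpTo-∸ f g M g≤f = begin
  sum (applyUpTo (λ k → f k ∸ g k) M) + sum (applyUpTo g M)
    ≡⟨ sum-applyUpTo-+ (λ k → f k ∸ g k) g M ⟨
  sum (applyUpTo (λ k → f k ∸ g k + g k) M)
    ≡⟨ cong sum (applyUpTo-cong M (λ k k< → m∸n+n≡m (g≤f k k<))) ⟩
  sum (applyUpTo f M)
    ∎
  where open ≡-Reasoning

sum-applyUpTo-0 : ∀ M → sum (applyUpTo (λ _ → 0) M) ≡ 0
sum-applyUpTo-0 zero    = refl
sum-applyUpTo-0 (suc M) = sum-applyUpTo-0 M

applyUpTo-reversed : ∀ (f g : ℕ → ℕ) M → (∀ k → k < M → g k ≡ f (M ∸ suc k)) →
                     applyUpTo g M ≡ applyDownFrom f M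
applyUpTo-reversed f g zero    g≡ = refl
applyUpTo-reversed f g (suc M) g≡ =
  cong₂ _∷_ (g≡ 0 (s≤s z≤n)) (applyUpTo-reversed f (g ∘ suc) M (λ k k< → g≡ (suc k) (s≤s k<)))

sum-applyDownFrom : ∀ (f : ℕ → ℕ) M → sum (applyDownFrom f M) ≡ sum (applyUpTo f M)
sum-applyDownFrom f M =
  trans (sym (sum-↭ (↭-reverse (applyDownFrom f M)))) (cong sum (reverse-applyDownFrom f M))

-- Column heights of Dyck paths

<ᵇ-true : x < c → (x <ᵇ c) ≡ true
<ᵇ-true {zero}  {suc c} _        = refl
<ᵇ-true {suc x} {suc c} (s≤s x<) = <ᵇ-true x<

<ᵇ-false : c ≤ x → (x <ᵇ c) ≡ false
<ᵇ-false {zero}  {x}     _        = refl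
<ᵇ-false {suc c} {suc x} (s≤s c≤) = <ᵇ-false c≤

count-∷ : ∀ (p : ℕ → Bool) x xs → count p (x ∷ xs) ≡ (if p x then 1 else 0) + count p xs
count-∷ p x xs with p x
... | true  = refl
... | false = refl

hc-∷-< : ∀ xs → x < c → hc (x ∷ xs) c ≡ suc (hc xs c)
hc-∷-< {x} {c} xs x<c = trans (count-∷ (_<ᵇ c) x xs) (cong (λ t → (if t then 1 else 0) + hc xs c) (<ᵇ-true x<c))

hc-∷-≥ : ∀ xs → c ≤ x → hc (x ∷ xs) c ≡ hc xs c
hc-∷-≥ {c} {x} xs c≤x = trans (count-∷ (_<ᵇ c) x xs) (cong (λ t → (if t then 1 else 0) + hc xs c) (<ᵇ-false c≤x))

hc-zero : ∀ xs → hc xs 0 ≡ 0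
hc-zero []       = refl
hc-zero (x ∷ xs) = trans (hc-∷-≥ {x = x} xs z≤n) (hc-zero xs)

hc≤length : ∀ xs c → hc xs c ≤ length xs
hc≤length xs c = length-filter (T? ∘ (_<ᵇ c)) xs

Sorted : List ℕ → Set
Sorted xs = T (nondecᵇ xs)

sorted-tail : ∀ x xs → Sorted (x ∷ xs) → Sorted xs
sorted-tail x []      _ = tt
sorted-tail x (y ∷ r) s = proj₂ (∧-split s)

hc-sorted-≤head : ∀ x xs → Sorted (x ∷ xs) → c ≤ x → hc (x ∷ xs) c ≡ 0
hc-sorted-≤head x []       s c≤x = hc-∷-≥ [] c≤x
hc-sorted-≤head x (y ∷ ys) s c≤x =
  trans (hc-∷-≥ (y ∷ ys) c≤x)
        (hc-sorted-≤head y ys (proj₂ (∧-split s)) (≤-trans c≤x (≤ᵇ⇒≤ x y (proj₁ (∧-split s)))))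

≤hc⇒nth< : ∀ xs → Sorted xs → suc j ≤ hc xs c → nth xs j < c
≤hc⇒nth< {j} {c} (x ∷ xs) s j< with x <? c
≤hc⇒nth< {zero}  (x ∷ xs) s j< | yes x<c = x<c
≤hc⇒nth< {suc j} (x ∷ xs) s j< | yes x<c =
  ≤hc⇒nth< xs (sorted-tail x xs s) (s≤s⁻¹ (subst (suc (suc j) ≤_) (hc-∷-< xs x<c) j<))
... | no x≮c = contradiction (subst (suc j ≤_) (hc-sorted-≤head x xs s (≮⇒≥ x≮c)) j<) λ ()

nth<⇒≤hc : ∀ xs → Sorted xs → j < length xs → nth xs j < c → suc j ≤ hc xs c
nth<⇒≤hc {zero}      (x ∷ xs) s _        x<c = subst (1 ≤_) (sym (hc-∷-< xs x<c)) (s≤s z≤n)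
nth<⇒≤hc {suc j} {c} (x ∷ xs) s (s≤s j<) lt with x <? c
... | yes x<c = subst (suc (suc j) ≤_) (sym (hc-∷-< xs x<c)) (s≤s (nth<⇒≤hc xs (sorted-tail x xs s) j< lt))
... | no  x≮c = contradiction (subst (suc j ≤_) hc≡0 (nth<⇒≤hc xs (sorted-tail x xs s) j< lt)) λ ()
  where hc≡0 = trans (sym (hc-∷-≥ xs (≮⇒≥ x≮c))) (hc-sorted-≤head x xs s (≮⇒≥ x≮c))

dyck-length : ∀ xs → IsDyck n xs → length xs ≡ n
dyck-length {n = n} xs dx = ≡ᵇ⇒≡ (length xs) n (proj₁ (∧-split dx))

dyck-sorted : ∀ xs → IsDyck n xs → Sorted xs
dyck-sorted {n = n} xs dx = proj₁ (∧-split (proj₂ (∧-split {length xs ≡ᵇ n} dx)))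

dyck-below-diagonal : ∀ xs → IsDyck n xs → k < n → nth xs k ≤ k
dyck-below-diagonal {n = n} {k = k} xs dx k<n = ≤ᵇ⇒≤ (nth xs k) k (and-applyUpTo _ n bounds k<n)
  where
  bounds = subst (T ∘ and) (map-range (λ j → at xs j ≤ᵇ (j ∸ 1)) n)
                 (proj₂ (∧-split {nondecᵇ xs} (proj₂ (∧-split {length xs ≡ᵇ n} dx))))

≤hc⇒at< : ∀ xs → IsDyck n xs → 1 ≤ r → r ≤ hc xs c → at xs r < c
≤hc⇒at< {r = suc j} xs dx _ r≤ = ≤hc⇒nth< xs (dyck-sorted xs dx) r≤

at<⇒≤hc : ∀ xs → IsDyck n xs → 1 ≤ r → r ≤ n → at xs r < c → r ≤ hc xs c
at<⇒≤hc {r = suc j} xs dx _ r≤n at< =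
  nth<⇒≤hc xs (dyck-sorted xs dx) (subst (suc j ≤_) (sym (dyck-length xs dx)) r≤n) at<

hc≤n : ∀ xs → IsDyck n xs → ∀ c → hc xs c ≤ n
hc≤n xs dx c = subst (hc xs c ≤_) (dyck-length xs dx) (hc≤length xs c)

hc<⇒≤at : ∀ xs → IsDyck n xs → r ≤ n → hc xs c < r → c ≤ at xs r
hc<⇒≤at {r = r} {c = c} xs dx r≤n hc<r with at xs r <? c
... | yes at< = contradiction (at<⇒≤hc xs dx (≤-trans (s≤s z≤n) hc<r) r≤n at<) (<⇒≱ hc<r)
... | no  at≮ = ≮⇒≥ at≮

hc-diagonal : ∀ xs → IsDyck n xs → 1 ≤ c → c ≤ n → c ≤ hc xs c
hc-diagonal {c = suc c} xs dx 1≤c c≤n = at<⇒≤hc xs dx 1≤c c≤n (s≤s (dyck-below-diagonal xs dx c≤n))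

hc-full : ∀ xs → IsDyck n xs → n ≤ c → hc xs c ≡ n
hc-full {n = zero}  {c = c} xs dx _   = n≤0⇒n≡0 (hc≤n xs dx c)
hc-full {n = suc n} {c = c} xs dx n≤c = ≤-antisym (hc≤n xs dx c)
  (at<⇒≤hc xs dx (s≤s z≤n) ≤-refl (<-≤-trans (s≤s (dyck-below-diagonal xs dx ≤-refl)) n≤c))

hc-mono : ∀ xs → IsDyck n xs → c ≤ d → hc xs c ≤ hc xs d
hc-mono {c = c} xs dx c≤d with hc xs c in eq
... | zero  = z≤n
... | suc r = at<⇒≤hc xs dx (s≤s z≤n) (subst (_≤ _) eq (hc≤n xs dx c))
                (<-≤-trans (≤hc⇒at< xs dx (s≤s z≤n) (≤-reflexive (sym eq))) c≤d)

hc<n⇒<n : ∀ xs → IsDyck n xs → hc xs c < n → c < n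
hc<n⇒<n {n = n} {c = c} xs dx hc<n with c <? n
... | yes c<n = c<n
... | no  c≮n = contradiction (subst (_< n) (hc-full xs dx (≮⇒≥ c≮n)) hc<n) (<-irrefl refl)

hc-unique : ∀ xs → IsDyck n xs → r ≤ n → (1 ≤ r → at xs r < c) → (r < n → c ≤ at xs (suc r)) →
            hc xs c ≡ r
hc-unique {n = n} {r = r} {c = c} xs dx r≤n row-r row-r+1 = ≤-antisym hc≤r (r≤hc r r≤n row-r)
  where
  hc≤r : hc xs c ≤ r
  hc≤r with hc xs c ≤? r
  ... | yes le = le
  ... | no  gt = contradiction (≤hc⇒at< xs dx (s≤s z≤n) (≰⇒> gt))
                               (≤⇒≯ (row-r+1 (<-≤-trans (≰⇒> gt) (hc≤n xs dx c))))
  r≤hc : ∀ r → r ≤ n → (1 ≤ r → at xs r < c) → r ≤ hc xs c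
  r≤hc zero    _   _   = z≤n
  r≤hc (suc r) r≤n row = at<⇒≤hc xs dx (s≤s z≤n) r≤n (row (s≤s z≤n))

hc-agree-below : ∀ xs ys → IsDyck n xs → IsDyck n ys → (∀ r → r ≤ a → at ys r ≡ at xs r) →
                 hc xs d < a → hc ys d ≡ hc xs d
hc-agree-below {d = d} xs ys dx dy agree hc<a =
  hc-unique ys dy (hc≤n xs dx d)
    (λ 1≤hc → subst (_< d) (sym (agree _ (<⇒≤ hc<a))) (≤hc⇒at< xs dx 1≤hc ≤-refl))
    (λ hc<n → subst (d ≤_) (sym (agree _ hc<a)) (hc<⇒≤at xs dx hc<n ≤-refl))

hc-agree-above : ∀ xs ys → IsDyck n xs → IsDyck n ys → (∀ r → a < r → at ys r ≡ at xs r) →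
                 at ys a < d → a ≤ hc xs d → hc ys d ≡ hc xs d
hc-agree-above {a = a} {d = d} xs ys dx dy agree at<d a≤hc =
  hc-unique ys dy (hc≤n xs dx d) row-hc
    (λ hc<n → subst (d ≤_) (sym (agree _ (s≤s a≤hc))) (hc<⇒≤at xs dx hc<n ≤-refl))
  where
  row-hc : 1 ≤ hc xs d → at ys (hc xs d) < d
  row-hc 1≤hc with m≤n⇒m<n∨m≡n a≤hc
  ... | inj₁ a<hc = subst (_< d) (sym (agree _ a<hc)) (≤hc⇒at< xs dx 1≤hc ≤-refl)
  ... | inj₂ a≡hc = subst (λ r → at ys r < d) a≡hc at<d

-- Area and the double count

sum-indicator : ∀ x M → sum (applyUpTo (λ k → if x <ᵇ suc k then 1 else 0) M) ≡ M ∸ x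
sum-indicator x       zero    = sym (0∸n≡0 x)
sum-indicator zero    (suc M) = cong suc (sum-indicator zero M)
sum-indicator (suc x) (suc M) = sum-indicator x M

double-count : ∀ xs M → (∀ k → k < length xs → nth xs k ≤ M) →
               sum (applyUpTo (λ k → hc xs (suc k)) M) + sum xs ≡ length xs * M
double-count []       M _   = cong (_+ 0) (sum-applyUpTo-0 M)
double-count (x ∷ xs) M x≤M = begin
  sum (applyUpTo (λ k → hc (x ∷ xs) (suc k)) M) + (x + sum xs)
    ≡⟨ cong (λ l → sum l + (x + sum xs)) (applyUpTo-cong M (λ k _ → count-∷ (_<ᵇ suc k) x xs)) ⟩
  sum (applyUpTo (λ k → (if x <ᵇ suc k then 1 else 0) + hc xs (suc k)) M) + (x + sum xs)
    ≡⟨ cong (_+ (x + sum xs)) (sum-applyUpTo-+ _ H M) ⟩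
  sum (applyUpTo (λ k → if x <ᵇ suc k then 1 else 0) M) + sum (applyUpTo H M) + (x + sum xs)
    ≡⟨ cong (λ t → t + sum (applyUpTo H M) + (x + sum xs)) (sum-indicator x M) ⟩
  M ∸ x + sum (applyUpTo H M) + (x + sum xs)
    ≡⟨ interchange +-commutativeSemigroup (M ∸ x) _ x (sum xs) ⟩
  M ∸ x + x + (sum (applyUpTo H M) + sum xs)
    ≡⟨ cong₂ _+_ (m∸n+n≡m (x≤M 0 (s≤s z≤n))) (double-count xs M (λ k k< → x≤M (suc k) (s≤s k<))) ⟩
  M + length xs * M
    ∎
  where
  open ≡-Reasoning
  H = λ k → hc xs (suc k)

dyck-double-count : ∀ xs → IsDyck n xs → sum (hseq n xs) + sum xs ≡ n * n
dyck-double-count {n} xs dx = begin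
  sum (hseq n xs) + sum xs                          ≡⟨ cong (λ l → sum l + sum xs) (map-range (hc xs) n) ⟩
  sum (applyUpTo (λ k → hc xs (suc k)) n) + sum xs  ≡⟨ double-count xs n entries≤n ⟩
  length xs * n                                     ≡⟨ cong (_* n) (dyck-length xs dx) ⟩
  n * n                                             ∎
  where
  open ≡-Reasoning
  entries≤n : ∀ k → k < length xs → nth xs k ≤ n
  entries≤n k k< = let k<n = subst (k <_) (dyck-length xs dx) k< in
                   ≤-trans (dyck-below-diagonal xs dx k<n) (<⇒≤ k<n)

rows-sum-from-heights : ∀ xs ys → IsDyck n xs → IsDyck n ys →
                        sum (hseq n ys) + k ≡ sum (hseq n xs) → sum ys ≡ k + sum xs
rows-sum-from-heights {n} {k} xs ys dx dy heights = +-cancelˡ-≡ (sum (hseq n ys)) (sum ys) (k + sum xs) (begin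
  sum (hseq n ys) + sum ys        ≡⟨ dyck-double-count ys dy ⟩
  n * n                           ≡⟨ dyck-double-count xs dx ⟨
  sum (hseq n xs) + sum xs        ≡⟨ cong (_+ sum xs) heights ⟨
  sum (hseq n ys) + k + sum xs    ≡⟨ +-assoc (sum (hseq n ys)) k (sum xs) ⟩
  sum (hseq n ys) + (k + sum xs)  ∎)
  where open ≡-Reasoning

area+sum : ∀ xs → IsDyck n xs → area n xs + sum xs ≡ sum (upTo n)
area+sum {n} xs dx = begin
  area n xs + sum xs
    ≡⟨ cong₂ _+_ (cong sum (map-range _ n)) (cong sum xs≡) ⟩
  sum (applyUpTo (λ k → k ∸ nth xs k) n) + sum (applyUpTo (nth xs) n)
    ≡⟨ sum-applyUpTo-∸ (λ k → k) (nth xs) n (λ k → dyck-below-diagonal xs dx) ⟩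
  sum (upTo n)
    ∎
  where
  open ≡-Reasoning
  xs≡ : xs ≡ applyUpTo (nth xs) n
  xs≡ = trans (sym (applyUpTo-nth xs)) (cong (applyUpTo (nth xs)) (dyck-length xs dx))

area-pred : ∀ π σ → IsDyck n π → IsDyck n σ → sum σ ≡ suc (sum π) → area n σ + 1 ≡ area n π
area-pred {n} π σ dπ dσ sum≡ = +-cancelʳ-≡ (sum π) _ _ (begin
  area n σ + 1 + sum π   ≡⟨ +-assoc (area n σ) 1 (sum π) ⟩
  area n σ + suc (sum π) ≡⟨ cong (area n σ +_) sum≡ ⟨
  area n σ + sum σ       ≡⟨ area+sum σ dσ ⟩
  sum (upTo n)           ≡⟨ area+sum π dπ ⟨
  area n π + sum π       ∎)
  where open ≡-Reasoning

-- The elementary steps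

bind-just : ∀ {X Y : Set} (m : Maybe X) {g : X → Maybe Y} {z} →
            (m >>= g) ≡ just z → ∃[ y ] m ≡ just y × g y ≡ just z
bind-just (just y) e = y , refl , e

if-just : ∀ {X : Set} b {m : Maybe X} {z} → (if b then m else nothing) ≡ just z → T b × m ≡ just z
if-just true e = tt , e

single-step : ∀ (f : Op) xs → seqOps (f ∷ []) xs ≡ just ys → f xs ≡ just ys
single-step f xs e with f xs
... | just y = e

seqOps-++ : ∀ fs gs xs → seqOps (fs ++ gs) xs ≡ just zs → ∃[ ys ] seqOps fs xs ≡ just ys × seqOps gs ys ≡ just zs
seqOps-++ []       gs xs e = xs , refl , e
seqOps-++ (f ∷ fs) gs xs e with bind-just (f xs) e
... | ys , f≡ , e′ with seqOps-++ fs gs ys e′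
...   | zs , fs≡ , gs≡ = zs , trans (cong (_>>= seqOps fs) f≡) fs≡ , gs≡

eqListᵇ-sound : ∀ xs ys → T (eqListᵇ xs ys) → xs ≡ ys
eqListᵇ-sound []       []       _ = refl
eqListᵇ-sound (x ∷ xs) (y ∷ ys) t =
  cong₂ _∷_ (≡ᵇ⇒≡ x y (proj₁ (∧-split t))) (eqListᵇ-sound xs ys (proj₂ (∧-split {x ≡ᵇ y} t)))

mkPath-just : ∀ n xs → mkPath n xs ≡ just ys → IsDyck n xs × xs ≡ ys
mkPath-just n xs e with if-just (isDyckᵇ n xs) e
... | dx , refl = dx , refl

pathFromH-just : ∀ n hs → pathFromH n hs ≡ just ys → IsDyck n ys × hseq n ys ≡ hs
pathFromH-just n hs e with if-just (isDyckᵇ n (xFromH n hs) ∧ eqListᵇ (hseq n (xFromH n hs)) hs) e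
... | checks , refl = proj₁ (∧-split checks) , eqListᵇ-sound _ _ (proj₂ (∧-split {isDyckᵇ n (xFromH n hs)} checks))

hseq-length : ∀ n xs → length (hseq n xs) ≡ n
hseq-length n xs = trans (cong length (map-range (hc xs) n)) (length-applyUpTo _ n)

hseq-nth : ∀ n xs → k < n → nth (hseq n xs) k ≡ hc xs (suc k)
hseq-nth n xs k<n = trans (cong (λ l → nth l _) (map-range (hc xs) n)) (nth-applyUpTo _ n k<n)

record Lowering (n : ℕ) (obs : List ℕ → ℕ → ℕ) (Φ : List ℕ → ℕ) (j δ : ℕ) (xs ys : List ℕ) : Set where
  field
    dyck      : IsDyck n ys
    lowered   : obs ys j ≡ obs xs j ∸ δ
    unchanged : ∀ j′ → j′ ≢ j → obs ys j′ ≡ obs xs j′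
    potential : Φ ys + δ ≡ Φ xs

Lowers : ℕ → (List ℕ → ℕ → ℕ) → (List ℕ → ℕ) → ℕ → Op → Set
Lowers n obs Φ j op = ∀ xs {ys} → IsDyck n xs → op xs ≡ just ys → Lowering n obs Φ j 1 xs ys

A-lowers : ∀ r → Lowers n at sum r (A n r)
A-lowers {n} (suc j) xs dx A≡ with if-just ((suc j ≤ᵇ n) ∧ (1 ≤ᵇ nth xs j)) A≡
... | guard , mk≡ with mkPath-just n (setNth xs j (nth xs j ∸ 1)) mk≡
...   | dy , refl = record
  { dyck      = dy
  ; lowered   = nth-setNth-same xs j<len
  ; unchanged = λ { zero _ → refl ; (suc k) k≢j → nth-setNth-other xs (k≢j ∘ cong suc) }
  ; potential = sum-setNth-pred xs j<len (≤ᵇ⇒≤ 1 (nth xs j) (proj₂ (∧-split guard)))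
  }
  where
  j<len : j < length xs
  j<len = subst (j <_) (sym (dyck-length xs dx)) (≤ᵇ⇒≤ (suc j) n (proj₁ (∧-split {suc j ≤ᵇ n} guard)))

Cinv-lowers : ∀ c → Lowers n hc (sum ∘ hseq n) c (Cinv n c)
Cinv-lowers {n} (suc c) xs {ys} dx C≡ with if-just ((suc c ≤ᵇ n) ∧ (1 ≤ᵇ hc xs (suc c))) C≡
... | guard , path≡ = record
  { dyck      = dy
  ; lowered   = trans (column c c<n) (nth-setNth-same (hseq n xs) c<len)
  ; unchanged = unchanged
  ; potential = begin
      sum (hseq n ys) + 1
        ≡⟨ cong (λ l → sum l + 1) heights ⟩
      sum hs + 1
        ≡⟨ cong (λ v → sum (setNth (hseq n xs) c (v ∸ 1)) + 1) (hseq-nth n xs c<n) ⟨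
      sum (setNth (hseq n xs) c (nth (hseq n xs) c ∸ 1)) + 1
        ≡⟨ sum-setNth-pred (hseq n xs) c<len (subst (1 ≤_) (sym (hseq-nth n xs c<n)) 1≤hc) ⟩
      sum (hseq n xs)
        ∎
  }
  where
  open ≡-Reasoning
  hs = setNth (hseq n xs) c (hc xs (suc c) ∸ 1)
  c<n : c < n
  c<n = ≤ᵇ⇒≤ (suc c) n (proj₁ (∧-split {suc c ≤ᵇ n} guard))
  1≤hc : 1 ≤ hc xs (suc c)
  1≤hc = ≤ᵇ⇒≤ 1 _ (proj₂ (∧-split {suc c ≤ᵇ n} guard))
  c<len : c < length (hseq n xs)
  c<len = subst (c <_) (sym (hseq-length n xs)) c<n
  dy : IsDyck n ys
  dy = proj₁ (pathFromH-just n hs path≡)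
  heights : hseq n ys ≡ hs
  heights = proj₂ (pathFromH-just n hs path≡)
  column : ∀ k → k < n → hc ys (suc k) ≡ nth hs k
  column k k<n = trans (sym (hseq-nth n ys k<n)) (cong (λ l → nth l k) heights)
  unchanged : ∀ d → d ≢ suc c → hc ys d ≡ hc xs d
  unchanged zero    _   = trans (hc-zero ys) (sym (hc-zero xs))
  unchanged (suc k) k≢c with suc k ≤? n
  ... | yes k<n = trans (column k k<n) (trans (nth-setNth-other (hseq n xs) (k≢c ∘ cong suc)) (hseq-nth n xs k<n))
  ... | no  k≮n = trans (hc-full ys dy (<⇒≤ (≰⇒> k≮n))) (sym (hc-full xs dx (<⇒≤ (≰⇒> k≮n))))

record Lowerings (n : ℕ) (obs : List ℕ → ℕ → ℕ) (Φ : List ℕ → ℕ) (crd δ : ℕ → ℕ) (M : ℕ)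
                 (xs ys : List ℕ) : Set where
  field
    dyck      : IsDyck n ys
    lowered   : ∀ k → k < M → obs ys (crd k) ≡ obs xs (crd k) ∸ δ k
    unchanged : ∀ j → (∀ k → k < M → crd k ≢ j) → obs ys j ≡ obs xs j
    potential : Φ ys + sum (applyUpTo δ M) ≡ Φ xs

module _ {n : ℕ} {obs : List ℕ → ℕ → ℕ} {Φ : List ℕ → ℕ} where

  Lowering-refl : IsDyck n xs → Lowering n obs Φ j 0 xs xs
  Lowering-refl dx = record { dyck = dx ; lowered = refl ; unchanged = λ _ _ → refl ; potential = +-identityʳ _ }

  Lowering-trans : ∀ {δ₁ δ₂} → Lowering n obs Φ j δ₁ xs ys → Lowering n obs Φ j δ₂ ys zs →
                   Lowering n obs Φ j (δ₁ + δ₂) xs zs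
  Lowering-trans {j} {xs} {ys} {zs} {δ₁} {δ₂} L₁ L₂ = record
    { dyck      = L₂.dyck
    ; lowered   = trans L₂.lowered (trans (cong (_∸ δ₂) L₁.lowered) (∸-+-assoc (obs xs j) δ₁ δ₂))
    ; unchanged = λ j′ j′≢j → trans (L₂.unchanged j′ j′≢j) (L₁.unchanged j′ j′≢j)
    ; potential = begin
        Φ zs + (δ₁ + δ₂) ≡⟨ cong (Φ zs +_) (+-comm δ₁ δ₂) ⟩
        Φ zs + (δ₂ + δ₁) ≡⟨ +-assoc (Φ zs) δ₂ δ₁ ⟨
        Φ zs + δ₂ + δ₁   ≡⟨ cong (_+ δ₁) L₂.potential ⟩
        Φ ys + δ₁        ≡⟨ L₁.potential ⟩
        Φ xs             ∎
    }
    where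
    open ≡-Reasoning
    module L₁ = Lowering L₁
    module L₂ = Lowering L₂

  pow-lowering : ∀ {op} → Lowers n obs Φ j op → ∀ δ xs → IsDyck n xs → pow op δ xs ≡ just ys →
                 Lowering n obs Φ j δ xs ys
  pow-lowering lowers zero    xs dx refl = Lowering-refl dx
  pow-lowering {op = op} lowers (suc δ) xs dx e with bind-just (op xs) e
  ... | ys , op≡ , rest = Lowering-trans first (pow-lowering lowers δ ys (Lowering.dyck first) rest)
    where first = lowers xs dx op≡

  phase-lowerings : ∀ {op : ℕ → Op} {crd δ : ℕ → ℕ} → (∀ j → Lowers n obs Φ j (op j)) →
                    (∀ k l → crd k ≡ crd l → k ≡ l) → ∀ M xs → IsDyck n xs →
                    seqOps (applyUpTo (λ k → pow (op (crd k)) (δ k)) M) xs ≡ just ys →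
                    Lowerings n obs Φ crd δ M xs ys
  phase-lowerings lowers crd-inj zero xs dx refl = record
    { dyck = dx ; lowered = λ _ () ; unchanged = λ _ _ → refl ; potential = +-identityʳ _ }
  phase-lowerings {ys = zs} {op} {crd} {δ} lowers crd-inj (suc M) xs dx e
    with bind-just (pow (op (crd 0)) (δ 0) xs) e
  ... | ys , pow≡ , rest = record
    { dyck      = R.dyck
    ; lowered   = lowered
    ; unchanged = λ j h → trans (R.unchanged j (λ k k< → h (suc k) (s≤s k<)))
                                (F.unchanged j (λ j≡ → h 0 (s≤s z≤n) (sym j≡)))
    ; potential = begin
        Φ zs + (δ 0 + S) ≡⟨ cong (Φ zs +_) (+-comm (δ 0) S) ⟩
        Φ zs + (S + δ 0) ≡⟨ +-assoc (Φ zs) S (δ 0) ⟨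
        Φ zs + S + δ 0   ≡⟨ cong (_+ δ 0) R.potential ⟩
        Φ ys + δ 0       ≡⟨ F.potential ⟩
        Φ xs             ∎
    }
    where
    open ≡-Reasoning
    S = sum (applyUpTo (δ ∘ suc) M)
    module F = Lowering (pow-lowering (lowers (crd 0)) (δ 0) xs dx pow≡)
    module R = Lowerings (phase-lowerings {crd = crd ∘ suc} {δ ∘ suc} lowers
                            (λ k l eq → suc-injective (crd-inj (suc k) (suc l) eq)) M ys F.dyck rest)
    lowered : ∀ k → k < suc M → obs zs (crd k) ≡ obs xs (crd k) ∸ δ k
    lowered zero    _        = trans (R.unchanged (crd 0) (λ k _ eq → 1+n≢0 (crd-inj (suc k) 0 eq))) F.lowered
    lowered (suc k) (s≤s k<) = trans (R.lowered k k<) (cong (_∸ δ (suc k)) (F.unchanged _ (1+n≢0 ∘ crd-inj (suc k) 0)))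

-- Bounce paths

data Walk (h : ℕ → ℕ) (n : ℕ) : ℕ → List ℕ → ℕ → Set where
  done : Walk h n a [] a
  step : a < n → h (a + 1) ≡ c → Walk h n c ws e → Walk h n a (c ∷ ws) e

Climbs : (ℕ → ℕ) → ℕ → Set
Climbs h n = ∀ a → a < n → a < h (a + 1)

hc-climbs : ∀ xs → IsDyck n xs → Climbs (hc xs) n
hc-climbs {n} xs dx a a<n =
  subst (_≤ hc xs (a + 1)) (+-comm a 1) (hc-diagonal xs dx (m≤n+m 1 a) (subst (_≤ n) (+-comm 1 a) a<n))

walk-++ : Walk h n a ws c → Walk h n c vs e → Walk h n a (ws ++ vs) e
walk-++ done               w = w
walk-++ (step a<n ha w′) w = step a<n ha (walk-++ w′ w)

walk-uncons : Walk h n a (c ∷ ws) e → a < n × h (a + 1) ≡ c × Walk h n c ws e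
walk-uncons (step a<n ha w) = a<n , ha , w

walk-end : Walk h n a [] e → a ≡ e
walk-end done = refl

walk-length : Climbs h n → Walk h n a ws e → length ws + a ≤ e
walk-length climbs done = ≤-refl
walk-length {h} {a = a} climbs (step {ws = ws} a<n refl w) =
  ≤-trans (subst (_≤ length ws + h (a + 1)) (+-suc (length ws) a) (+-monoʳ-≤ (length ws) (climbs a a<n)))
          (walk-length climbs w)

walk-transfer : Climbs h n → (∀ d → a < d → d ≤ e → h′ d ≡ h d) → Walk h n a ws e → Walk h′ n a ws e
walk-transfer climbs agree done = done
walk-transfer {h} {a = a} climbs agree (step {ws = ws} a<n refl w) =
  step a<n (agree (a + 1) (m<m+n a (s≤s z≤n)) (≤-trans a+1≤c (≤-trans (m≤n+m _ (length ws)) (walk-length climbs w))))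
       (walk-transfer climbs (λ d c<d d≤e → agree d (<-trans (climbs a a<n) c<d) d≤e) w)
  where
  a+1≤c : a + 1 ≤ h (a + 1)
  a+1≤c = subst (_≤ h (a + 1)) (+-comm 1 a) (climbs a a<n)

bounceFrom-< : ∀ xs f → a < n → bounceFrom n xs (suc f) a ≡ hc xs (a + 1) ∷ bounceFrom n xs f (hc xs (a + 1))
bounceFrom-< {a} {n} xs f a<n =
  cong (λ t → if t then hc xs (a + 1) ∷ bounceFrom n xs f (hc xs (a + 1)) else []) (<ᵇ-true a<n)

bounceFrom-≥ : ∀ xs f → n ≤ a → bounceFrom n xs f a ≡ []
bounceFrom-≥                 xs zero    n≤a = refl
bounceFrom-≥ {n = n} {a = a} xs (suc f) n≤a =
  cong (λ t → if t then hc xs (a + 1) ∷ bounceFrom n xs f (hc xs (a + 1)) else []) (<ᵇ-false n≤a)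

bounceFrom-walk : ∀ xs f → Walk (hc xs) n a ws n → length ws ≤ f → bounceFrom n xs f a ≡ ws
bounceFrom-walk xs f       done              _           = bounceFrom-≥ xs f ≤-refl
bounceFrom-walk xs (suc f) (step a<n refl w) (s≤s len≤f) =
  trans (bounceFrom-< xs f a<n) (cong (_ ∷_) (bounceFrom-walk xs f w len≤f))

walk-bounceFrom : ∀ xs f → IsDyck n xs → a ≤ n → n ≤ f + a → Walk (hc xs) n a (bounceFrom n xs f a) n
walk-bounceFrom {n} {a} xs f dx a≤n n≤f+a with a <? n
walk-bounceFrom {n} {a} xs zero    dx a≤n n≤a   | yes a<n = contradiction n≤a (<⇒≱ a<n)
walk-bounceFrom {n} {a} xs (suc f) dx a≤n n≤f+a | yes a<n =
  subst (λ l → Walk (hc xs) n a l n) (sym (bounceFrom-< xs f a<n))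
        (step a<n refl (walk-bounceFrom xs f dx (hc≤n xs dx (a + 1)) (≤-trans n≤f+a f+a<f+c)))
  where
  f+a<f+c : suc f + a ≤ f + hc xs (a + 1)
  f+a<f+c = subst (_≤ f + hc xs (a + 1)) (+-suc f a) (+-monoʳ-≤ f (hc-climbs xs dx a a<n))
... | no a≮n = subst (λ l → Walk (hc xs) n a l n) (sym (bounceFrom-≥ xs f (≮⇒≥ a≮n)))
                     (subst (Walk (hc xs) n a []) (≤-antisym a≤n (≮⇒≥ a≮n)) done)

bouncePts-walk : ∀ xs → IsDyck n xs → Walk (hc xs) n 0 (bouncePts n xs) n
bouncePts-walk {n} xs dx = walk-bounceFrom xs n dx z≤n (≤-reflexive (sym (+-identityʳ n)))

walk-bouncePts : ∀ xs → IsDyck n xs → Walk (hc xs) n 0 ws n → bouncePts n xs ≡ ws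
walk-bouncePts {n} {ws} xs dx w =
  bounceFrom-walk xs n w (subst (_≤ n) (+-identityʳ (length ws)) (walk-length (hc-climbs xs dx) w))

record WalkSplit (h : ℕ → ℕ) (n a : ℕ) (ws : List ℕ) (e k : ℕ) : Set where
  field
    prefix suffix : List ℕ
    ws≡           : ws ≡ prefix ++ nth ws k ∷ suffix
    length-prefix : length prefix ≡ k
    walk-prefix   : Walk h n a prefix (nth (a ∷ ws) k)
    walk-suffix   : Walk h n (nth (a ∷ ws) k) (nth ws k ∷ suffix) e

walk-split : Walk h n a ws e → ∀ k → k < length ws → WalkSplit h n a ws e k
walk-split (step {ws = ws} a<n ha w) zero _ = record
  { prefix = [] ; suffix = ws ; ws≡ = refl ; length-prefix = refl ; walk-prefix = done ; walk-suffix = step a<n ha w }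
walk-split (step {c = c} a<n ha w) (suc k) (s≤s k<) = record
  { prefix        = c ∷ S.prefix
  ; suffix        = S.suffix
  ; ws≡           = cong (c ∷_) S.ws≡
  ; length-prefix = cong suc S.length-prefix
  ; walk-prefix   = step a<n ha S.walk-prefix
  ; walk-suffix   = S.walk-suffix
  }
  where module S = WalkSplit (walk-split w k k<)

record BounceSplit (n : ℕ) (π : List ℕ) (i : ℕ) : Set where
  field
    prefix suffix : List ℕ
    bounce≡       : bouncePts n π ≡ prefix ++ bp n π (suc i) ∷ suffix
    length-prefix : length prefix ≡ i
    walk-prefix   : Walk (hc π) n 0 prefix (bp n π i)
    p<n           : bp n π i < n
    hp            : hc π (bp n π i + 1) ≡ bp n π (suc i)
    walk-suffix   : Walk (hc π) n (bp n π (suc i)) suffix n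

bounce-split : ∀ π → IsDyck n π → i < nBounce n π → BounceSplit n π i
bounce-split {n} {i} π dπ i<m = record
  { prefix        = S.prefix
  ; suffix        = S.suffix
  ; bounce≡       = S.ws≡
  ; length-prefix = S.length-prefix
  ; walk-prefix   = subst (Walk (hc π) n 0 S.prefix) (sym (at≡nth-0∷ bs i)) S.walk-prefix
  ; p<n           = proj₁ step-at-p
  ; hp            = proj₁ (proj₂ step-at-p)
  ; walk-suffix   = proj₂ (proj₂ step-at-p)
  }
  where
  bs = bouncePts n π
  module S = WalkSplit (walk-split (bouncePts-walk π dπ) i i<m)
  step-at-p = walk-uncons (subst (λ p → Walk (hc π) n p (nth bs i ∷ S.suffix) n) (sym (at≡nth-0∷ bs i)) S.walk-suffix)

nBounce-split : ∀ {b} → bouncePts n π ≡ pre ++ b ∷ rest → length pre ≡ i → nBounce n π ≡ suc (i + length rest)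
nBounce-split {n = n} {π = π} {pre = pre} {rest = rest} {i = i} {b} bounce≡ len = begin
  length (bouncePts n π)          ≡⟨ cong length bounce≡ ⟩
  length (pre ++ b ∷ rest)        ≡⟨ length-++ pre ⟩
  length pre + suc (length rest)  ≡⟨ cong (_+ suc (length rest)) len ⟩
  i + suc (length rest)           ≡⟨ +-suc i (length rest) ⟩
  suc (i + length rest)           ∎
  where open ≡-Reasoning

bounce-++ : ∀ π → bouncePts n π ≡ pre ++ vs → bounce n π ≡ sum (map (n ∸_) pre) + sum (map (n ∸_) vs)
bounce-++ {n} {pre} {vs} π bounce≡ =
  trans (cong (sum ∘ map (n ∸_)) bounce≡) (trans (cong sum (map-++ (n ∸_) pre vs)) (sum-++ (map (n ∸_) pre) _))

bounce-suc : ∀ π σ → bouncePts n π ≡ pre ++ vs → bouncePts n σ ≡ pre ++ ws →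
             sum (map (n ∸_) ws) ≡ suc (sum (map (n ∸_) vs)) → bounce n σ ≡ bounce n π + 1
bounce-suc {n} {pre} {vs} {ws} π σ π≡ σ≡ ws≡ = begin
  bounce n σ                ≡⟨ bounce-++ {n} {pre} σ σ≡ ⟩
  P + sum (map (n ∸_) ws)   ≡⟨ cong (P +_) ws≡ ⟩
  P + suc V                 ≡⟨ +-suc P V ⟩
  suc (P + V)               ≡⟨ +-comm 1 (P + V) ⟩
  P + V + 1                 ≡⟨ cong (_+ 1) (bounce-++ {n} {pre} π π≡) ⟨
  bounce n π + 1            ∎
  where
  open ≡-Reasoning
  P = sum (map (n ∸_) pre)
  V = sum (map (n ∸_) vs)

-- The operator U

U-β : List ℕ → ℕ → ℕ → ℕ → ℕ → ℕ
U-β π p b u j = (hc π (p + u + 2 ∸ j) ∸ b) + 1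

-- With p = b_{i-1}, b = b_i, b′ = b_{i+1} and u the width, this is the operator list run by U_i.
U-steps : ℕ → List ℕ → ℕ → ℕ → ℕ → ℕ → List Op
U-steps n π p b b′ u =
  Cinv n (p + 1) ∷ (map (λ k → pow (Cinv n (p + 1 + k)) (U-β π p b u (u + 1 ∸ k))) (range u)
                   ++ map (λ k → pow (A n (b′ ∸ u + k)) (U-β π p b u k)) (range u))

U-width : ℕ → List ℕ → ℕ → ℕ
U-width n π i = if i ≡ᵇ nBounce n π then 0 else bp n π (i + 1) ∸ hc π (bp n π i)

U-just : ∀ n i π → U n (suc i) π ≡ just σ →
         seqOps (U-steps n π (bp n π i) (bp n π (suc i)) (bp n π (suc i + 1)) (U-width n π (suc i))) π ≡ just σ
U-just n i π = else-just (hc π (bp n π i) ≡ᵇ bp n π (suc i))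
  where
  else-just : ∀ {X : Set} b {m : Maybe X} {z} → (if b then nothing else m) ≡ just z → m ≡ just z
  else-just false e = e

≡ᵇ-refl : ∀ x → (x ≡ᵇ x) ≡ true
≡ᵇ-refl zero    = refl
≡ᵇ-refl (suc x) = ≡ᵇ-refl x

<⇒≡ᵇ-false : x < c → (x ≡ᵇ c) ≡ false
<⇒≡ᵇ-false {zero}  {suc c} _        = refl
<⇒≡ᵇ-false {suc x} {suc c} (s≤s x<) = <⇒≡ᵇ-false x<

U-width-last : ∀ n π i → suc i ≡ nBounce n π → U-width n π (suc i) ≡ 0
U-width-last n π i i+1≡m = cong (λ t → if t then 0 else bp n π (suc i + 1) ∸ hc π (bp n π (suc i)))
                                (subst (λ m → (suc i ≡ᵇ m) ≡ true) i+1≡m (≡ᵇ-refl (suc i)))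

U-width-inner : ∀ n π i → suc i < nBounce n π → U-width n π (suc i) ≡ bp n π (suc i + 1) ∸ hc π (bp n π (suc i))
U-width-inner n π i i+1<m = cong (λ t → if t then 0 else bp n π (suc i + 1) ∸ hc π (bp n π (suc i)))
                                 (<⇒≡ᵇ-false i+1<m)

-- The C⁻¹ steps lower column p+1+k by β_{u+1-k}, an amount read off the height of that same column.
mirror-column : ∀ p u k → k < u → p + u + 2 ∸ (u + 1 ∸ suc k) ≡ p + 1 + suc k
mirror-column p u k k<u with m≤n⇒∃[o]m+o≡n k<u
... | t , refl = begin
  p + (suc k + t) + 2 ∸ (suc k + t + 1 ∸ suc k) ≡⟨ cong (p + (suc k + t) + 2 ∸_) u+1∸k+1≡t+1 ⟩
  p + (suc k + t) + 2 ∸ (t + 1)                 ≡⟨ cong (_∸ (t + 1)) (rearrange p k t) ⟩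
  p + 1 + suc k + (t + 1) ∸ (t + 1)             ≡⟨ m+n∸n≡m (p + 1 + suc k) (t + 1) ⟩
  p + 1 + suc k                                 ∎
  where
  open ≡-Reasoning
  u+1∸k+1≡t+1 : suc k + t + 1 ∸ suc k ≡ t + 1
  u+1∸k+1≡t+1 = trans (cong (_∸ suc k) (+-assoc (suc k) t 1)) (m+n∸m≡n (suc k) (t + 1))
  rearrange : ∀ p k t → p + (suc k + t) + 2 ≡ p + 1 + suc k + (t + 1)
  rearrange = solve-∀

mirror-index : ∀ u k → k < u → u + 1 ∸ suc k ≡ suc (u ∸ suc k)
mirror-index u k k<u = trans (cong (_∸ suc k) (+-comm u 1)) (+-∸-assoc 1 k<u)

∸-level : ∀ {b h} → b ≤ h → h ∸ ((h ∸ b) + 1) ≡ b ∸ 1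
∸-level {b} {h} b≤h = trans (sym (∸-+-assoc h (h ∸ b) 1)) (cong (_∸ 1) (m∸[m∸n]≡n b≤h))

∸-pos-< : 1 ≤ x → 1 ≤ y → x ∸ y < x
∸-pos-< {suc x} {suc y} _ _ = s≤s (m∸n≤m x y)

∸-pred : ∀ {b} → 1 ≤ b → b ≤ n → n ∸ (b ∸ 1) ≡ suc (n ∸ b)
∸-pred {suc n} {suc b} _ (s≤s b≤n) = +-∸-assoc 1 b≤n

record BouncePointLowered (n p b b′ : ℕ) (π σ : List ℕ) : Set where
  field
    dyck    : IsDyck n σ
    sum-suc : sum σ ≡ suc (sum π)
    below   : ∀ d → d ≤ p → hc σ d ≡ hc π d
    at-p+1  : hc σ (p + 1) ≡ b ∸ 1
    at-b    : hc σ b ≡ b′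
    above   : ∀ d → b < d → hc σ d ≡ hc π d

module LevelAndShift {n : ℕ} (π σ : List ℕ) (dπ : IsDyck n π) {p b b′ : ℕ}
                     (p<n : p < n) (hp : hc π (p + 1) ≡ b) (b<n : b < n) (hb : hc π (b + 1) ≡ b′)
                     (steps : seqOps (U-steps n π p b b′ (b′ ∸ hc π b)) π ≡ just σ) where

  a₀ u : ℕ
  a₀ = hc π b
  u  = b′ ∸ a₀

  β column row : ℕ → ℕ
  β = U-β π p b u
  column k = p + 1 + suc k
  row k = b′ ∸ u + suc k

  1≤β : ∀ j → 1 ≤ β j
  1≤β j = m≤n+m 1 (hc π (p + u + 2 ∸ j) ∸ b)

  1≤b : 1 ≤ b
  1≤b = ≤-trans (s≤s z≤n) (subst (p <_) hp (hc-climbs π dπ p p<n))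

  b∸1<b : b ∸ 1 < b
  b∸1<b = ∸-monoʳ-< (s≤s z≤n) 1≤b

  b≤a₀ : b ≤ a₀
  b≤a₀ = hc-diagonal π dπ 1≤b (<⇒≤ b<n)

  a₀≤b′ : a₀ ≤ b′
  a₀≤b′ = subst (a₀ ≤_) hb (hc-mono π dπ (m≤m+n b 1))

  b′≤n : b′ ≤ n
  b′≤n = subst (_≤ n) hb (hc≤n π dπ (b + 1))

  a₀+u≡b′ : a₀ + u ≡ b′
  a₀+u≡b′ = m+[n∸m]≡n a₀≤b′

  row≡ : ∀ k → row k ≡ a₀ + suc k
  row≡ k = cong (_+ suc k) (m∸[m∸n]≡n a₀≤b′)

  C-phase A-phase : List Op
  C-phase = map (λ k → pow (Cinv n (p + 1 + k)) (β (u + 1 ∸ k))) (range u)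
  A-phase = map (λ k → pow (A n (b′ ∸ u + k)) (β k)) (range u)

  private
    first  = bind-just (Cinv n (p + 1) π) steps
    π₀     = proj₁ first
    phases = seqOps-++ C-phase A-phase π₀ (proj₂ (proj₂ first))

  τ : List ℕ
  τ = proj₁ phases

  C₀ : Lowering n hc (sum ∘ hseq n) (p + 1) 1 π π₀
  C₀ = Cinv-lowers (p + 1) π dπ (proj₁ (proj₂ first))
  module C₀ = Lowering C₀

  Cs : Lowerings n hc (sum ∘ hseq n) column (λ k → β (u + 1 ∸ suc k)) u π₀ τ
  Cs = phase-lowerings {op = Cinv n} Cinv-lowers (λ k l eq → suc-injective (+-cancelˡ-≡ (p + 1) _ _ eq)) u π₀ C₀.dyck
         (subst (λ fs → seqOps fs π₀ ≡ just τ) (map-range _ u) (proj₁ (proj₂ phases)))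
  module Cs = Lowerings Cs

  As : Lowerings n at sum row (β ∘ suc) u τ σ
  As = phase-lowerings {op = A n} A-lowers (λ k l eq → suc-injective (+-cancelˡ-≡ (b′ ∸ u) _ _ eq)) u τ Cs.dyck
         (subst (λ fs → seqOps fs τ ≡ just σ) (map-range _ u) (proj₂ (proj₂ phases)))
  module As = Lowerings As

  τ-outside : ∀ d → d ≤ p ⊎ p + 1 + u < d → hc τ d ≡ hc π d
  τ-outside d (inj₁ d≤p) =
    trans (Cs.unchanged d (λ k _ eq → <⇒≱ (subst (p <_) eq (<-≤-trans (m<m+n p (s≤s z≤n)) (m≤m+n (p + 1) (suc k)))) d≤p))
          (C₀.unchanged d (<⇒≢ (≤-<-trans d≤p (m<m+n p (s≤s z≤n)))))
  τ-outside d (inj₂ u<d) =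
    trans (Cs.unchanged d (λ k k<u eq → <⇒≱ (subst (p + 1 + u <_) (sym eq) u<d) (+-monoʳ-≤ (p + 1) k<u)))
          (C₀.unchanged d (λ eq → <⇒≱ (subst (p + 1 + u <_) eq u<d) (m≤m+n (p + 1) u)))

  column≢p+1 : ∀ k → column k ≢ p + 1
  column≢p+1 k eq = 1+n≢0 (+-cancelˡ-≡ (p + 1) (suc k) 0 (trans eq (sym (+-identityʳ (p + 1)))))

  τ-at-p+1 : hc τ (p + 1) ≡ b ∸ 1
  τ-at-p+1 = trans (Cs.unchanged (p + 1) (λ k _ → column≢p+1 k)) (trans C₀.lowered (cong (_∸ 1) hp))

  τ-levelled : ∀ k → k ≤ u → hc τ (p + 1 + k) ≡ b ∸ 1
  τ-levelled zero    _   = trans (cong (hc τ) (+-identityʳ (p + 1))) τ-at-p+1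
  τ-levelled (suc k) k<u = begin
    hc τ (column k)                                ≡⟨ Cs.lowered k k<u ⟩
    hc π₀ (column k) ∸ β (u + 1 ∸ suc k)           ≡⟨ cong₂ _∸_ (C₀.unchanged (column k) (column≢p+1 k))
                                                             (cong (λ j → (hc π j ∸ b) + 1) (mirror-column p u k k<u)) ⟩
    hc π (column k) ∸ ((hc π (column k) ∸ b) + 1) ≡⟨ ∸-level b≤h ⟩
    b ∸ 1                                          ∎
    where
    open ≡-Reasoning
    b≤h : b ≤ hc π (column k)
    b≤h = subst (_≤ hc π (column k)) hp (hc-mono π dπ (m≤m+n (p + 1) (suc k)))

  p+1+u<b : p + 1 + u < b
  p+1+u<b = ≤-<-trans (subst (p + 1 + u ≤_) (τ-levelled u ≤-refl) on-diagonal) b∸1<b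
    where
    in-range : p + 1 + u < n
    in-range = hc<n⇒<n τ Cs.dyck (subst (_< n) (sym (τ-levelled u ≤-refl)) (≤-<-trans (m∸n≤m b 1) b<n))
    on-diagonal : p + 1 + u ≤ hc τ (p + 1 + u)
    on-diagonal = hc-diagonal τ Cs.dyck (≤-trans (m≤n+m 1 p) (m≤m+n (p + 1) u)) (<⇒≤ in-range)

  τ-at-b : hc τ b ≡ a₀
  τ-at-b = τ-outside b (inj₂ p+1+u<b)

  τ-at-b+1 : hc τ (b + 1) ≡ b′
  τ-at-b+1 = trans (τ-outside (b + 1) (inj₂ (<-trans p+1+u<b (m<m+n b (s≤s z≤n))))) hb

  τ-row : ∀ k → k < u → at τ (row k) ≡ b
  τ-row k k<u = ≤-antisym (s≤s⁻¹ (subst (at τ (row k) <_) (+-comm b 1) upper)) lower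
    where
    row≤b′ : row k ≤ b′
    row≤b′ = subst₂ _≤_ (sym (row≡ k)) a₀+u≡b′ (+-monoʳ-≤ a₀ k<u)
    upper : at τ (row k) < b + 1
    upper = ≤hc⇒at< τ Cs.dyck (subst (1 ≤_) (sym (row≡ k)) (≤-trans (s≤s z≤n) (m≤n+m (suc k) a₀)))
                    (subst (row k ≤_) (sym τ-at-b+1) row≤b′)
    lower : b ≤ at τ (row k)
    lower = hc<⇒≤at τ Cs.dyck (≤-trans row≤b′ b′≤n)
                    (subst₂ _<_ (sym τ-at-b) (sym (row≡ k)) (m<m+n a₀ (s≤s z≤n)))

  σ-row-low : ∀ r → r ≤ a₀ → at σ r ≡ at τ r
  σ-row-low r r≤a₀ =
    As.unchanged r (λ k _ eq → <⇒≱ (subst (a₀ <_) (trans (sym (row≡ k)) eq) (m<m+n a₀ (s≤s z≤n))) r≤a₀)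

  σ-row-high : ∀ r → b′ < r → at σ r ≡ at τ r
  σ-row-high r b′<r =
    As.unchanged r (λ k k<u eq → <⇒≱ b′<r (subst₂ _≤_ (trans (sym (row≡ k)) eq) a₀+u≡b′ (+-monoʳ-≤ a₀ k<u)))

  σ-rows<b : ∀ k → k ≤ u → at σ (a₀ + k) < b
  σ-rows<b zero    _   = subst (λ r → at σ r < b) (sym (+-identityʳ a₀))
    (subst (_< b) (sym (σ-row-low a₀ ≤-refl)) (≤hc⇒at< τ Cs.dyck (≤-trans 1≤b b≤a₀) (≤-reflexive (sym τ-at-b))))
  σ-rows<b (suc k) k<u = subst (λ r → at σ r < b) (row≡ k)
    (subst (_< b) (sym (trans (As.lowered k k<u) (cong (_∸ β (suc k)) (τ-row k k<u)))) (∸-pos-< 1≤b (1≤β (suc k))))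

  σ-at-b′ : at σ b′ < b
  σ-at-b′ = subst (λ r → at σ r < b) a₀+u≡b′ (σ-rows<b u ≤-refl)

  σ-low : ∀ d → d ≤ p + 1 → hc σ d ≡ hc τ d
  σ-low d d≤p+1 = hc-agree-below {d = d} τ σ Cs.dyck As.dyck σ-row-low
    (≤-<-trans (hc-mono {c = d} τ Cs.dyck d≤p+1) (subst (_< a₀) (sym τ-at-p+1) (<-≤-trans b∸1<b b≤a₀)))

  σ-high : ∀ d → b < d → hc σ d ≡ hc π d
  σ-high d b<d = trans (hc-agree-above τ σ Cs.dyck As.dyck σ-row-high (<-trans σ-at-b′ b<d) b′≤hc)
                       (τ-outside d (inj₂ (<-trans p+1+u<b b<d)))
    where
    b′≤hc : b′ ≤ hc τ d
    b′≤hc = subst (_≤ hc τ d) τ-at-b+1 (hc-mono τ Cs.dyck (subst (_≤ d) (+-comm 1 b) b<d))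

  σ-at-b : hc σ b ≡ b′
  σ-at-b = hc-unique σ As.dyck b′≤n (λ _ → σ-at-b′) λ b′<n →
    subst (b ≤_) (sym (σ-row-high (suc b′) ≤-refl))
      (≤-trans (m≤m+n b 1) (hc<⇒≤at τ Cs.dyck b′<n (subst (_< suc b′) (sym τ-at-b+1) ≤-refl)))

  C-amounts≡A-amounts : sum (applyUpTo (λ k → β (u + 1 ∸ suc k)) u) ≡ sum (applyUpTo (β ∘ suc) u)
  C-amounts≡A-amounts =
    trans (cong sum (applyUpTo-reversed (β ∘ suc) _ u (λ k k<u → cong β (mirror-index u k k<u))))
          (sum-applyDownFrom (β ∘ suc) u)

  sum-suc : sum σ ≡ suc (sum π)
  sum-suc = +-cancelʳ-≡ Sβ (sum σ) (suc (sum π)) (begin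
    sum σ + Sβ       ≡⟨ As.potential ⟩
    sum τ            ≡⟨ rows-sum-from-heights π τ dπ Cs.dyck heights ⟩
    Sδ + 1 + sum π   ≡⟨ cong (λ t → t + 1 + sum π) C-amounts≡A-amounts ⟩
    Sβ + 1 + sum π   ≡⟨ +-comm (Sβ + 1) (sum π) ⟩
    sum π + (Sβ + 1) ≡⟨ cong (sum π +_) (+-comm Sβ 1) ⟩
    sum π + suc Sβ   ≡⟨ +-suc (sum π) Sβ ⟩
    suc (sum π) + Sβ ∎)
    where
    open ≡-Reasoning
    Sδ = sum (applyUpTo (λ k → β (u + 1 ∸ suc k)) u)
    Sβ = sum (applyUpTo (β ∘ suc) u)
    heights : sum (hseq n τ) + (Sδ + 1) ≡ sum (hseq n π)
    heights = trans (sym (+-assoc (sum (hseq n τ)) Sδ 1)) (trans (cong (_+ 1) Cs.potential) C₀.potential)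

  bounce-point-lowered : BouncePointLowered n p b b′ π σ
  bounce-point-lowered = record
    { dyck    = As.dyck
    ; sum-suc = sum-suc
    ; below   = λ d d≤p → trans (σ-low d (≤-trans d≤p (m≤m+n p 1))) (τ-outside d (inj₁ d≤p))
    ; at-p+1  = trans (σ-low (p + 1) ≤-refl) τ-at-p+1
    ; at-b    = σ-at-b
    ; above   = σ-high
    }

inner-bounce : ∀ {p b b′} π σ → IsDyck n π → BouncePointLowered n p b b′ π σ → p < n → hc π (p + 1) ≡ b →
               b < n → hc π (b + 1) ≡ b′ → Walk (hc π) n 0 pre p → Walk (hc π) n b′ rest n →
               bouncePts n π ≡ pre ++ b ∷ b′ ∷ rest → bounce n σ ≡ bounce n π + 1
inner-bounce {n = n} {pre = pre} {rest = rest} {p} {b} {b′} π σ dπ L p<n hp b<n hb w-pre w-rest bounce≡ =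
  bounce-suc π σ bounce≡ (walk-bouncePts σ L.dyck walkσ)
             (cong (_+ sum (map (n ∸_) (b′ ∷ rest))) (∸-pred 1≤b (<⇒≤ b<n)))
  where
  module L = BouncePointLowered L
  climbs = hc-climbs π dπ
  1≤b : 1 ≤ b
  1≤b = ≤-trans (s≤s z≤n) (subst (p <_) hp (climbs p p<n))
  b<b′ : b < b′
  b<b′ = subst (b <_) hb (climbs b b<n)
  walkσ : Walk (hc σ) n 0 (pre ++ b ∸ 1 ∷ b′ ∷ rest) n
  walkσ = walk-++ (walk-transfer climbs (λ d _ d≤p → L.below d d≤p) w-pre)
            (step p<n L.at-p+1
              (step (≤-<-trans (m∸n≤m b 1) b<n) (trans (cong (hc σ) (m∸n+n≡m 1≤b)) L.at-b)
                (walk-transfer climbs (λ d b′<d _ → L.above d (<-trans b<b′ b′<d)) w-rest)))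

last-bounce : ∀ {p} π σ → IsDyck n π → Lowering n hc (sum ∘ hseq n) (p + 1) 1 π σ →
              p < n → hc π (p + 1) ≡ n → Walk (hc π) n 0 pre p → bouncePts n π ≡ pre ++ n ∷ [] → bounce n σ ≡ bounce n π + 1
last-bounce {n = n} {pre = pre} {p} π σ dπ L p<n hp w-pre bounce≡ =
  bounce-suc π σ bounce≡ (walk-bouncePts σ L.dyck walkσ) (cong (_+ (n ∸ n + 0)) (m∸[m∸n]≡n 1≤n))
  where
  module L = Lowering L
  1≤n : 1 ≤ n
  1≤n = ≤-trans (s≤s z≤n) p<n
  walkσ : Walk (hc σ) n 0 (pre ++ n ∸ 1 ∷ n ∷ []) n
  walkσ = walk-++ (walk-transfer (hc-climbs π dπ) (λ d _ d≤p → L.unchanged d (<⇒≢ (≤-<-trans d≤p p<p+1))) w-pre)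
            (step p<n (trans L.lowered (cong (_∸ 1) hp))
              (step (∸-monoʳ-< (s≤s z≤n) 1≤n) (trans (cong (hc σ) (m∸n+n≡m 1≤n)) (hc-full σ L.dyck ≤-refl))
                done))
    where p<p+1 = m<m+n p (s≤s z≤n)

U-inner : ∀ π σ → IsDyck n π → suc i < nBounce n π → U n (suc i) π ≡ just σ →
          (area n σ + 1 ≡ area n π) × (bounce n σ ≡ bounce n π + 1)
U-inner {n} {i} π σ dπ i+1<m Uπ≡σ = inner suffix bounce≡ walk-suffix
  where
  open BounceSplit (bounce-split π dπ (<-trans (n<1+n i) i+1<m))
  p b b′ : ℕ
  p  = bp n π i
  b  = bp n π (suc i)
  b′ = bp n π (suc i + 1)
  steps : seqOps (U-steps n π p b b′ (b′ ∸ hc π b)) π ≡ just σ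
  steps = subst (λ w → seqOps (U-steps n π p b b′ w) π ≡ just σ) (U-width-inner n π i i+1<m) (U-just n i π Uπ≡σ)
  next≡ : ∀ c rest → bouncePts n π ≡ prefix ++ b ∷ c ∷ rest → b′ ≡ c
  next≡ c rest bounce≡ = begin
    nth (bouncePts n π) (i + 1)                       ≡⟨ cong (λ l → nth l (i + 1)) bounce≡ ⟩
    nth (prefix ++ b ∷ c ∷ rest) (i + 1)              ≡⟨ cong (λ k → nth (prefix ++ b ∷ c ∷ rest) (k + 1)) length-prefix ⟨
    nth (prefix ++ b ∷ c ∷ rest) (length prefix + 1)  ≡⟨ nth-++ʳ prefix 1 ⟩
    c                                                 ∎
    where open ≡-Reasoning
  inner : ∀ sfx → bouncePts n π ≡ prefix ++ b ∷ sfx → Walk (hc π) n b sfx n →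
          (area n σ + 1 ≡ area n π) × (bounce n σ ≡ bounce n π + 1)
  inner [] bounce≡ _ = contradiction m≡i+1 (<⇒≢ i+1<m ∘ sym)
    where
    m≡i+1 : nBounce n π ≡ suc i
    m≡i+1 = trans (nBounce-split {n = n} {π = π} bounce≡ length-prefix) (cong suc (+-identityʳ i))
  inner (c ∷ rest) bounce≡ w with walk-uncons w | next≡ c rest bounce≡
  ... | b<n , hb , w-rest | refl =
    area-pred π σ dπ L.dyck L.sum-suc , inner-bounce π σ dπ L p<n hp b<n hb walk-prefix w-rest bounce≡
    where
    L = LevelAndShift.bounce-point-lowered π σ dπ p<n hp b<n hb steps
    module L = BouncePointLowered L

U-last : ∀ π σ → IsDyck n π → suc i ≡ nBounce n π → U n (suc i) π ≡ just σ →
         (area n σ + 1 ≡ area n π) × (bounce n σ ≡ bounce n π + 1)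
U-last {n} {i} π σ dπ i+1≡m Uπ≡σ = last suffix bounce≡ walk-suffix
  where
  open BounceSplit (bounce-split π dπ (subst (i <_) i+1≡m (n<1+n i)))
  p b : ℕ
  p = bp n π i
  b = bp n π (suc i)
  C≡ : Cinv n (p + 1) π ≡ just σ
  C≡ = single-step (Cinv n (p + 1)) π
         (subst (λ w → seqOps (U-steps n π p b (bp n π (suc i + 1)) w) π ≡ just σ)
                (U-width-last n π i i+1≡m) (U-just n i π Uπ≡σ))
  L = Cinv-lowers (p + 1) π dπ C≡
  module L = Lowering L
  last : ∀ sfx → bouncePts n π ≡ prefix ++ b ∷ sfx → Walk (hc π) n b sfx n →
         (area n σ + 1 ≡ area n π) × (bounce n σ ≡ bounce n π + 1)
  last [] bounce≡ w =
    area-pred π σ dπ L.dyck (rows-sum-from-heights π σ dπ L.dyck L.potential) ,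
    last-bounce π σ dπ L p<n (trans hp b≡n) walk-prefix (subst (λ x → bouncePts n π ≡ prefix ++ x ∷ []) b≡n bounce≡)
    where
    b≡n : b ≡ n
    b≡n = walk-end w
  last (c ∷ rest) bounce≡ _ = contradiction (suc-injective i+1≡i+2+r) (m≢1+m+n i)
    where
    i+1≡i+2+r : suc i ≡ suc (suc (i + length rest))
    i+1≡i+2+r = trans i+1≡m (trans (nBounce-split {n = n} {π = π} bounce≡ length-prefix) (cong suc (+-suc i _)))

proposition4p1 : (n : ℕ) (π : List ℕ) → IsDyck n π →
                 (i : ℕ) → 1 ≤ i → i ≤ nBounce n π →
                 (σ : List ℕ) → U n i π ≡ just σ →
                 (area n σ + 1 ≡ area n π) × (bounce n σ ≡ bounce n π + 1)
proposition4p1 n π dπ (suc i) _ i≤m σ Uπ≡σ with m≤n⇒m<n∨m≡n i≤m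
... | inj₁ i<m = U-inner π σ dπ i<m Uπ≡σ
... | inj₂ i≡m = U-last π σ dπ i≡m Uπ≡σ
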